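{- Let $T,T'$ be theories in the logic $\mathcal{L}_\alpha^\beta$. If there is a faithful interpretation from $T$ into $T'$, then $\mathsf{Cz}(T)\le\mathsf{Cz}(T')$. Consequently, if $T$ and $T'$ are definitionally equivalent, then $\mathsf{Cz}(T)=\mathsf{Cz}(T')$.
   Context: Fix ordinals $\alpha$ and $\beta\le\alpha+1$. The logic $\mathcal{L}_\alpha^\beta$: a language is a set of relation symbols, each with rank an ordinal $<\beta$ (no function/constant symbols); variables $v_i$, $i<\alpha$; the formulas $Fm$ of a language are built from $v_i=v_j$ and $R(v_{i_m}:m<\mathrm{rank}(R))$ by $\land,\lnot,\exists v_i$; models are nonempty sets with relations interpreting the symbols, with standard Tarskian satisfaction (a formula is true in a model if satisfied by every assignment). A theory is a set of formulas; $T\models\varphi$ iff $\varphi$ is true in every model of $T$. A translation $tr:Fm\to Fm'$ satisfies $tr(v_i=v_j)=(v_i=v_j)$ and commutes with $\lnot$, $\land$, $\exists v_i$. It is an interpretation of $T$ into $T'$ if $T\models\varphi\Rightarrow T'\models tr(\varphi)$ for all $\varphi\in Fm$, and faithful if $T\models\varphi\iff T'\models tr(\varphi)$. $T$ and $T'$ are definitionally equivalent if there are interpretations $tr:Fm\to Fm'$ of $T$ into $T'$ and $tr':Fm'\to Fm$ of $T'$ into $T$ with $T\models tr'(tr(\varphi))\leftrightarrow\varphi$ and $T'\models tr(tr'(\psi))\leftrightarrow\psi$ for all $\varphi\in Fm$, $\psi\in Fm'$. The conceptual size $\mathsf{Cz}(T)\in\mathbb{N}\cup\{\infty\}$ is the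 number of elements of $\{[\varphi]_T:\varphi\in Fm\}$ where $[\varphi]_T=\{\psi\in Fm:T\models\varphi\leftrightarrow\psi\}$, taken to be $\infty$ if this set is infinite. -}

module Defs where

open import Data.Nat using (ℕ; _≤_)
open import Data.Fin using (Fin)
open import Data.Product using (Σ; _×_; _,_; ∃)
open import Data.Empty using (⊥)
open import Data.Unit using (⊤)
open import Relation.Nullary using (¬_; yes; no)
open import Relation.Binary.PropositionalEquality using (_≡_)
open import Relation.Binary.Structures using (IsStrictTotalOrder)
open import Induction.WellFounded using (WellFounded)

-- Ordinals: a (small) type with a well-founded strict total order.
-- The variables v_i, i < α, are indexed by the elements of α.

record Ordinal : Set₁ where
  field
    Carrier : Set
    _<_     : Carrier → Carrier → Set
    isSTO   : IsStrictTotalOrder _≡_ _<_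
    wf      : WellFounded _<_
  open IsStrictTotalOrder isSTO public using (_≟_)

open Ordinal public using (Carrier)

-- Ordinals ≤ α+1 (possible values of β):  an element a of α, α itself, or α+1.
data OrdLeSuc (α : Ordinal) : Set where
  ord   : Carrier α → OrdLeSuc α
  ordα  : OrdLeSuc α
  ordα1 : OrdLeSuc α

-- Ordinals < α+1 (possible ranks): an element a of α, or α itself.
data Rank (α : Ordinal) : Set where
  rk  : Carrier α → Rank α
  rkα : Rank α

_<β_ : {α : Ordinal} → Rank α → OrdLeSuc α → Set
_<β_ {α} (rk a) (ord b) = Ordinal._<_ α a b
rk a <β ordα  = ⊤
rk a <β ordα1 = ⊤
rkα  <β ord b = ⊥
rkα  <β ordα  = ⊥
rkα  <β ordα1 = ⊤

Arity : {α : Ordinal} → Rank α → Set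
Arity {α} (rk a) = Σ (Carrier α) (λ x → Ordinal._<_ α x a)
Arity {α} rkα    = Carrier α

record Language (α : Ordinal) (β : OrdLeSuc α) : Set₁ where
  field
    Sym    : Set
    rank   : Sym → Rank α
    rank<β : (R : Sym) → rank R <β β

open Language public

module _ {α : Ordinal} {β : OrdLeSuc α} (L : Language α β) where

  Var : Set
  Var = Carrier α

  data Fm : Set where
    _≐_  : Var → Var → Fm
    rel  : (R : Sym L) → (Arity (rank L R) → Var) → Fm
    _∧_  : Fm → Fm → Fm
    ¬'_  : Fm → Fm
    ∃'   : Var → Fm → Fm

  _⟷_ : Fm → Fm → Fm
  φ ⟷ ψ = (¬' (φ ∧ (¬' ψ))) ∧ (¬' (ψ ∧ (¬' φ)))

  record Model : Set₁ where
    field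
      M      : Set
      inhab  : M
      relM   : (R : Sym L) → (Arity (rank L R) → M) → Set

  open Model public

  update : {A : Set} → (Var → A) → Var → A → Var → A
  update s i m j with Ordinal._≟_ α i j
  ... | yes _ = m
  ... | no  _ = s j

  Sat : (𝔐 : Model) → (Var → M 𝔐) → Fm → Set
  Sat 𝔐 s (i ≐ j)   = s i ≡ s j
  Sat 𝔐 s (rel R xs) = relM 𝔐 R (λ k → s (xs k))
  Sat 𝔐 s (φ ∧ ψ)   = Sat 𝔐 s φ × Sat 𝔐 s ψ
  Sat 𝔐 s (¬' φ)    = ¬ Sat 𝔐 s φ
  Sat 𝔐 s (∃' i φ)  = Σ (M 𝔐) (λ m → Sat 𝔐 (update s i m) φ)

  TrueIn : Model → Fm → Set
  TrueIn 𝔐 φ = (s : Var → M 𝔐) → Sat 𝔐 s φ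

  Theory : Set₁
  Theory = Fm → Set

  _⊨_ : Theory → Fm → Set₁
  T ⊨ φ = (𝔐 : Model) → ((ψ : Fm) → T ψ → TrueIn 𝔐 ψ) → TrueIn 𝔐 φ

  Equiv : Theory → Fm → Fm → Set₁
  Equiv T φ ψ = T ⊨ (φ ⟷ ψ)

module _ {α : Ordinal} {β : OrdLeSuc α} where

  record Translation (L L' : Language α β) : Set where
    field
      tr    : Fm L → Fm L'
      tr-≐  : ∀ i j → tr (_≐_ i j) ≡ _≐_ i j
      tr-¬  : ∀ φ → tr (¬' φ) ≡ ¬' (tr φ)
      tr-∧  : ∀ φ ψ → tr (φ ∧ ψ) ≡ (tr φ ∧ tr ψ)
      tr-∃  : ∀ i φ → tr (∃' i φ) ≡ ∃' i (tr φ)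

  open Translation public

  IsInterpretation : {L L' : Language α β} → Translation L L' →
                     Theory L → Theory L' → Set₁
  IsInterpretation {L} {L'} t T T' = (φ : Fm L) → _⊨_ L T φ → _⊨_ L' T' (tr t φ)

  IsFaithful : {L L' : Language α β} → Translation L L' →
               Theory L → Theory L' → Set₁
  IsFaithful {L} {L'} t T T' =
    IsInterpretation t T T' × ((φ : Fm L) → _⊨_ L' T' (tr t φ) → _⊨_ L T φ)

  DefEquivalent : {L L' : Language α β} → Theory L → Theory L' → Set₁
  DefEquivalent {L} {L'} T T' =
    Σ (Translation L L') λ t → Σ (Translation L' L) λ t' →
      IsInterpretation t T T' × IsInterpretation t' T' T ×
      ((φ : Fm L)  → _⊨_ L  T  (_⟷_ L (tr t' (tr t φ)) φ)) ×
      ((ψ : Fm L') → _⊨_ L' T' (_⟷_ L' (tr t (tr t' ψ)) ψ))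

data ℕ∞ : Set where
  fin : ℕ → ℕ∞
  ∞   : ℕ∞

data _≤∞_ : ℕ∞ → ℕ∞ → Set where
  fin≤fin : ∀ {m n} → m ≤ n → fin m ≤∞ fin n
  _≤∞∞    : ∀ c → c ≤∞ ∞

-- HasCz T c :  Cz(T) = c.
--  * Cz(T) = n  iff there are n formulas, pairwise T-inequivalent, such that
--    every formula is T-equivalent to one of them (exactly n classes);
--  * Cz(T) = ∞  iff for every n there are n pairwise T-inequivalent formulas
--    (infinitely many classes).
module _ {α : Ordinal} {β : OrdLeSuc α} (L : Language α β) where

  PairwiseInequiv : Theory L → {n : ℕ} → (Fin n → Fm L) → Set₁
  PairwiseInequiv T f = ∀ i j → Equiv L T (f i) (f j) → i ≡ j

  HasCz : Theory L → ℕ∞ → Set₁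
  HasCz T (fin n) = Σ (Fin n → Fm L) λ f →
    PairwiseInequiv T f × ((φ : Fm L) → ∃ λ i → Equiv L T φ (f i))
  HasCz T ∞ = (n : ℕ) → Σ (Fin n → Fm L) λ f → PairwiseInequiv T f

-- A translation commutes with the connectives, so it sends φ ↔ ψ to tr φ ↔ tr ψ.
-- Faithfulness (or, for definitional equivalence, the round trip tr' ∘ tr) then
-- makes T'-equivalence of tr φ and tr ψ imply T-equivalence of φ and ψ.  Hence
-- tr induces an injection from T-classes into T'-classes, and by the pigeonhole
-- principle Cz(T) ≤ Cz(T').  Definitional equivalence gives both inequalities.
module Submission where

open import Defs
open import Data.Product using (Σ; _×_; _,_; proj₁; proj₂; ∃)
open import Data.Nat using (ℕ; suc; _≤_)
open import Data.Nat.Properties using (≤-antisym; 1+n≰n)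
open import Data.Fin using (Fin)
open import Data.Fin.Properties using (injective⇒≤)
open import Data.Empty using (⊥-elim)
open import Function.Definitions using (Injective)
open import Relation.Binary.PropositionalEquality
  using (_≡_; refl; sym; trans; subst; cong; cong₂)

module _ {α : Ordinal} {β : OrdLeSuc α} where

  -- The formulas are explicit: Equiv unfolds to satisfaction clauses, from which
  -- unification cannot recover them.
  module _ (L : Language α β) (T : Theory L) where

    Equiv-sym : ∀ φ ψ → Equiv L T φ ψ → Equiv L T ψ φ
    Equiv-sym _ _ φ↔ψ 𝔐 ⊨T s = proj₂ (φ↔ψ 𝔐 ⊨T s) , proj₁ (φ↔ψ 𝔐 ⊨T s)

    Equiv-trans : ∀ φ ψ χ → Equiv L T φ ψ → Equiv L T ψ χ → Equiv L T φ χ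
    Equiv-trans _ _ _ φ↔ψ ψ↔χ 𝔐 ⊨T s =
      (λ { (φ , ¬χ) → proj₁ (φ↔ψ 𝔐 ⊨T s) (φ , λ ψ → proj₁ (ψ↔χ 𝔐 ⊨T s) (ψ , ¬χ)) }) ,
      (λ { (χ , ¬φ) → proj₂ (ψ↔χ 𝔐 ⊨T s) (χ , λ ψ → proj₂ (φ↔ψ 𝔐 ⊨T s) (ψ , ¬φ)) })

  tr-⟷ : {L L' : Language α β} (t : Translation L L') (φ ψ : Fm L) →
         tr t (_⟷_ L φ ψ) ≡ _⟷_ L' (tr t φ) (tr t ψ)
  tr-⟷ {L} t φ ψ =
    trans (tr-∧ t _ _) (cong₂ _∧_ (tr-¬∧¬ φ ψ) (tr-¬∧¬ ψ φ))
    where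
    tr-¬∧¬ : (φ ψ : Fm L) → tr t (¬' (φ ∧ (¬' ψ))) ≡ ¬' (tr t φ ∧ (¬' tr t ψ))
    tr-¬∧¬ φ ψ = trans (tr-¬ t _)
      (cong ¬'_ (trans (tr-∧ t _ _) (cong (tr t φ ∧_) (tr-¬ t ψ))))

  module _ {L L' : Language α β} where

    ReflectsEquiv : Translation L L' → Theory L → Theory L' → Set₁
    ReflectsEquiv t T T' =
      ∀ φ ψ → Equiv L' T' (tr t φ) (tr t ψ) → Equiv L T φ ψ

    module _ {T : Theory L} {T' : Theory L'} (t : Translation L L') where

      faithful⇒reflectsEquiv : IsFaithful t T T' → ReflectsEquiv t T T'
      faithful⇒reflectsEquiv (_ , reflect) φ ψ tφ↔tψ =
        reflect (_⟷_ L φ ψ) (subst (_⊨_ L' T') (sym (tr-⟷ t φ ψ)) tφ↔tψ)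

      retract⇒reflectsEquiv : (t' : Translation L' L) → IsInterpretation t' T' T →
        ((φ : Fm L) → Equiv L T (tr t' (tr t φ)) φ) → ReflectsEquiv t T T'
      retract⇒reflectsEquiv t' t'-interp roundtrip φ ψ tφ↔tψ =
        Equiv-trans L T φ (tr t' (tr t φ)) ψ
          (Equiv-sym L T (tr t' (tr t φ)) φ (roundtrip φ))
          (Equiv-trans L T (tr t' (tr t φ)) (tr t' (tr t ψ)) ψ t'tφ↔t'tψ (roundtrip ψ))
        where
        t'tφ↔t'tψ : Equiv L T (tr t' (tr t φ)) (tr t' (tr t ψ))
        t'tφ↔t'tψ = subst (_⊨_ L T) (tr-⟷ t' _ _) (t'-interp _ tφ↔tψ)

      inequiv≤classes : ReflectsEquiv t T T' →
        {n n' : ℕ} (f : Fin n → Fm L) → PairwiseInequiv L T f →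
        (g : Fin n' → Fm L') → ((φ : Fm L') → ∃ λ i → Equiv L' T' φ (g i)) →
        n ≤ n'
      inequiv≤classes reflects f f-inequiv g cover = injective⇒≤ class-injective
        where
        class : Fin _ → Fin _
        class i = proj₁ (cover (tr t (f i)))

        class-injective : Injective _≡_ _≡_ class
        class-injective {i} {j} same =
          f-inequiv i j (reflects (f i) (f j)
            (Equiv-trans L' T' (tr t (f i)) (g (class i)) (tr t (f j))
              (proj₂ (cover (tr t (f i))))
              (subst (λ k → Equiv L' T' (g k) (tr t (f j))) (sym same)
                (Equiv-sym L' T' (tr t (f j)) (g (class j)) (proj₂ (cover (tr t (f j))))))))

      reflectsEquiv⇒Cz≤ : ReflectsEquiv t T T' →
        (c c' : ℕ∞) → HasCz L T c → HasCz L' T' c' → c ≤∞ c'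
      reflectsEquiv⇒Cz≤ _ c ∞ _ _ = c ≤∞∞
      reflectsEquiv⇒Cz≤ reflects (fin n) (fin n') (f , f-inequiv , _) (g , _ , cover) =
        fin≤fin (inequiv≤classes reflects f f-inequiv g cover)
      reflectsEquiv⇒Cz≤ reflects ∞ (fin n') infinite (g , _ , cover) =
        let f , f-inequiv = infinite (suc n') in
        ⊥-elim (1+n≰n (inequiv≤classes reflects f f-inequiv g cover))

≤∞-antisym : {c c' : ℕ∞} → c ≤∞ c' → c' ≤∞ c → c ≡ c'
≤∞-antisym (fin≤fin m≤n) (fin≤fin n≤m) = cong fin (≤-antisym m≤n n≤m)
≤∞-antisym (∞ ≤∞∞) _ = refl

proposition4p3 : (α : Ordinal) (β : OrdLeSuc α) (L L' : Language α β)
    (T : Theory L) (T' : Theory L') →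
    ((Σ (Translation L L') λ t → IsFaithful t T T') →
      (c c' : ℕ∞) → HasCz L T c → HasCz L' T' c' → c ≤∞ c')
    × (DefEquivalent T T' →
      (c c' : ℕ∞) → HasCz L T c → HasCz L' T' c' → c ≡ c')
proposition4p3 α β L L' T T' =
  (λ (t , faithful) → reflectsEquiv⇒Cz≤ t (faithful⇒reflectsEquiv t faithful)) ,
  λ (t , t' , t-interp , t'-interp , roundtrip , roundtrip') c c' Cz Cz' →
    ≤∞-antisym
      (reflectsEquiv⇒Cz≤ t (retract⇒reflectsEquiv t t' t'-interp roundtrip) c c' Cz Cz')
      (reflectsEquiv⇒Cz≤ t' (retract⇒reflectsEquiv t' t t-interp roundtrip') c' c Cz' Cz)
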